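{- Let $n\ge 26$. For each integer $a$ with $6\le a\le \lfloor (n+4)/5\rfloor$ and $n-a\equiv 0\pmod 2$, and each integer $b$ with $4\le b\le a-2$, the partition $\left(\tfrac12(n-a-2b+2),\ a+1,\ b+1,\ 3,\ 2\times(b-3),\ 1\times\tfrac12(n-a-4b)\right)$ of $n$ corresponds to the eigenvalue $\binom a2-b$ of $\mathrm{Cay}(S_n,T_n)$.
   Context: $\mathrm{Cay}(S_n,T_n)$ is the Cayley graph on the symmetric group $S_n$ generated by the set $T_n$ of all transpositions ($f\sim g$ iff $fg^{ -1}\in T_n$). For a partition $\lambda=(\lambda_1,\dots,\lambda_k)$ of $n$ (parts listed in the order written), put $\rho_\lambda=\sum_{i=1}^k \lambda_i(\lambda_i-2i+1)/2$; the eigenvalues of $\mathrm{Cay}(S_n,T_n)$ are exactly the numbers $\rho_\lambda$ as $\lambda$ ranges over partitions of $n$, and $\lambda$ is said to correspond to the eigenvalue $\rho_\lambda$. The notation $(\mu_1\times t_1,\dots,\mu_r\times t_r)$ denotes the sequence in which $\mu_i$ is repeated $t_i$ times; an entry $\mu$ without "$\times t$" is a single part, and $\mu\times 0$ contributes no parts. -}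

module Defs where

open import Data.Nat as ℕ using (ℕ; suc; _≤_; _≥_; _>_)
open import Data.Integer as ℤ using (ℤ; +_)
open import Data.List using (List; []; _∷_)
open import Data.Nat.ListAction using (sum)
open import Data.List.Relation.Unary.All using (All)
open import Data.List.Relation.Unary.Linked using (Linked)
open import Data.Product using (_×_)
open import Relation.Binary.PropositionalEquality using (_≡_)

IsPartitionOf : ℕ → List ℕ → Set
IsPartitionOf n λs = (sum λs ≡ n) × All (_> 0) λs × Linked _≥_ λs

ρ-from : ℕ → List ℕ → ℤ
ρ-from i [] = + 0
ρ-from i (x ∷ xs) =
  ((+ x) ℤ.* ((+ x) ℤ.- (+ (2 ℕ.* i)) ℤ.+ (+ 1))) ℤ./ (+ 2)
  ℤ.+ ρ-from (suc i) xs

-- ρ_λ = Σ_{i=1}^{k} λ_i (λ_i - 2i + 1) / 2  (each summand is an integer)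
ρ : List ℕ → ℤ
ρ = ρ-from 1

CorrespondsTo : List ℕ → ℤ → Set
CorrespondsTo λs e = ρ λs ≡ e

{-# OPTIONS --safe #-}
-- Write n = a + 2t. The partition is then (t - b + 1, a + 1, b + 1, 3, 2^(b-3), 1^(t-2b)): its parts
-- sum to a + 2t, and they are non-increasing because t ≥ a + b, which follows from n ≥ 5a - 4 and
-- a ≥ b + 2. Each summand λ_i (λ_i - 2i + 1) / 2 of ρ is an integer, so 2ρ is a polynomial in the
-- parts; a block of k equal parts v starting in row i contributes k v (v + 2 - 2i - k) to it.
-- Substituting the parts, every term in t cancels and 2ρ = a (a - 1) - 2b = 2 (C(a,2) - b).
module Submission where

open import Defs
open import Data.List using (List; []; _∷_; _++_; replicate; length)
open import Data.List.Properties using (length-replicate)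
open import Data.Nat.ListAction using (sum)
open import Data.Nat.ListAction.Properties using (sum-++)
open import Data.Nat.Combinatorics using (_C_; nC1≡n; nCk+nC[k+1]≡[n+1]C[k+1])
open import Relation.Binary.PropositionalEquality
open import Data.Product using (_×_; _,_; ∃-syntax)
open import Data.Nat as ℕ using (ℕ; zero; suc)
import Data.Nat.Properties as ℕ
import Data.Nat.DivMod as ℕ

stair : ℕ → ℕ → ℕ → ℕ → ℕ → List ℕ
stair p q r k m = p ∷ q ∷ r ∷ 3 ∷ (replicate k 2 ++ replicate m 1)

-- The partition of the theorem, with t = (n - a) / 2.
shape : ℕ → ℕ → ℕ → List ℕ
shape a b t = stair (t ℕ.∸ b ℕ.+ 1) (a ℕ.+ 1) (b ℕ.+ 1) (b ℕ.∸ 3) (t ℕ.∸ 2 ℕ.* b)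

sum-replicate : ∀ k x → sum (replicate k x) ≡ k ℕ.* x
sum-replicate zero    x = refl
sum-replicate (suc k) x = cong (x ℕ.+_) (sum-replicate k x)

2*n/2≡n : ∀ n → 2 ℕ.* n ℕ./ 2 ≡ n
2*n/2≡n n = trans (cong (ℕ._/ 2) (ℕ.*-comm 2 n)) (ℕ.m*n/n≡m n 2)

module _ where
  open import Data.Integer using (ℤ; +_; -[1+_]; _+_; _-_; _*_; _/_)
  open import Data.Integer.Properties
    using (pos-*; +-injective; +-identityˡ; +-assoc; *-distribˡ-+; *-cancelˡ-≡; ⊖-≥; m-n≡m⊖n; +-*-ring)
  open import Data.Integer.DivMod using (div-pos-is-/ℕ)
  open import Algebra.Bundles using (Ring)
  open import Algebra.Properties.RingWithoutOne (Ring.ringWithoutOne +-*-ring) using (x[y-z]≈xy-xz)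
  open import Data.Integer.Tactic.RingSolver using (solve-∀)
  open ≡-Reasoning

  2*i/2≡i : ∀ i → + 2 * i / + 2 ≡ i
  2*i/2≡i (+ n) = begin
    + 2 * + n / + 2    ≡⟨ cong (_/ + 2) (pos-* 2 n) ⟨
    + (2 ℕ.* n) / + 2  ≡⟨ div-pos-is-/ℕ (+ (2 ℕ.* n)) 2 ⟩
    + (2 ℕ.* n ℕ./ 2)  ≡⟨ cong +_ (2*n/2≡n n) ⟩
    + n                ∎
  -- Division of a negative integer first inspects the remainder, here 2 (n + 1) % 2 = 0.
  2*i/2≡i -[1+ n ]
    rewrite trans (cong (ℕ._% 2) (ℕ.*-comm 2 (suc n))) (ℕ.m*n%n≡0 (suc n) 2)
          | 2*n/2≡n (suc n) | ℕ.+-identityʳ n = refl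

  2*nC2≡n*[n-1] : ∀ n → + 2 * + (n C 2) ≡ + n * (+ n - + 1)
  2*nC2≡n*[n-1] zero    = refl
  2*nC2≡n*[n-1] (suc n) = begin
    + 2 * + (suc n C 2)            ≡⟨ cong (λ c → + 2 * + c) (nCk+nC[k+1]≡[n+1]C[k+1] n 1) ⟨
    + 2 * (+ (n C 1) + + (n C 2))  ≡⟨ cong (λ c → + 2 * (+ c + + (n C 2))) (nC1≡n n) ⟩
    + 2 * (+ n + + (n C 2))        ≡⟨ *-distribˡ-+ (+ 2) (+ n) (+ (n C 2)) ⟩
    + 2 * + n + + 2 * + (n C 2)    ≡⟨ cong (_+_ (+ 2 * + n)) (2*nC2≡n*[n-1] n) ⟩
    + 2 * + n + + n * (+ n - + 1)  ≡⟨ pascal (+ n) ⟩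
    + suc n * (+ suc n - + 1)      ∎
    where
    pascal : ∀ x → + 2 * x + x * (x - + 1) ≡ (+ 1 + x) * (+ 1 + x - + 1)
    pascal = solve-∀

  row-even : ∀ x i → + x * (+ x - + 2 * + i + + 1) ≡ + 2 * (+ (suc x C 2) - + x * + i)
  row-even x i = begin
    + x * (+ x - + 2 * + i + + 1)                       ≡⟨ expand (+ x) (+ i) ⟩
    + suc x * (+ suc x - + 1) - + 2 * (+ x * + i)       ≡⟨ cong (_- + 2 * (+ x * + i)) (2*nC2≡n*[n-1] (suc x)) ⟨
    + 2 * + (suc x C 2) - + 2 * (+ x * + i)             ≡⟨ x[y-z]≈xy-xz (+ 2) (+ (suc x C 2)) (+ x * + i) ⟨
    + 2 * (+ (suc x C 2) - + x * + i)                   ∎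
    where
    expand : ∀ x i → x * (x - + 2 * i + + 1) ≡ (+ 1 + x) * (+ 1 + x - + 1) - + 2 * (x * i)
    expand = solve-∀

  -- Twice ρ-from, but free of the division, so that the ring solver applies to it.
  ρ₂-from : ℕ → List ℕ → ℤ
  ρ₂-from i []       = + 0
  ρ₂-from i (x ∷ xs) = + x * (+ x - + 2 * + i + + 1) + ρ₂-from (suc i) xs

  2ρ-from≡ρ₂-from : ∀ i xs → + 2 * ρ-from i xs ≡ ρ₂-from i xs
  2ρ-from≡ρ₂-from i []       = refl
  2ρ-from≡ρ₂-from i (x ∷ xs) = begin
    + 2 * (half-row + ρ-from (suc i) xs)
      ≡⟨ *-distribˡ-+ (+ 2) half-row (ρ-from (suc i) xs) ⟩
    + 2 * half-row + + 2 * ρ-from (suc i) xs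
      ≡⟨ cong₂ _+_ twice-half-row (2ρ-from≡ρ₂-from (suc i) xs) ⟩
    + x * (+ x - + 2 * + i + + 1) + ρ₂-from (suc i) xs
      ∎
    where
    half-row : ℤ
    half-row = + x * (+ x - + (2 ℕ.* i) + + 1) / + 2
    twice-half-row : + 2 * half-row ≡ + x * (+ x - + 2 * + i + + 1)
    twice-half-row = begin
      + 2 * half-row
        ≡⟨ cong (λ j → + 2 * (+ x * (+ x - j + + 1) / + 2)) (pos-* 2 i) ⟩
      + 2 * (+ x * (+ x - + 2 * + i + + 1) / + 2)
        ≡⟨ cong (λ r → + 2 * (r / + 2)) (row-even x i) ⟩
      + 2 * (+ 2 * (+ (suc x C 2) - + x * + i) / + 2)
        ≡⟨ cong (+ 2 *_) (2*i/2≡i _) ⟩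
      + 2 * (+ (suc x C 2) - + x * + i)
        ≡⟨ row-even x i ⟨
      + x * (+ x - + 2 * + i + + 1)
        ∎

  ρ₂-from-++ : ∀ i xs ys → ρ₂-from i (xs ++ ys) ≡ ρ₂-from i xs + ρ₂-from (i ℕ.+ length xs) ys
  ρ₂-from-++ i []       ys = begin
    ρ₂-from i ys                ≡⟨ cong (λ j → ρ₂-from j ys) (ℕ.+-identityʳ i) ⟨
    ρ₂-from (i ℕ.+ 0) ys        ≡⟨ +-identityˡ _ ⟨
    + 0 + ρ₂-from (i ℕ.+ 0) ys  ∎
  ρ₂-from-++ i (x ∷ xs) ys = begin
    row + ρ₂-from (suc i) (xs ++ ys)
      ≡⟨ cong (_+_ row) (ρ₂-from-++ (suc i) xs ys) ⟩
    row + (ρ₂-from (suc i) xs + ρ₂-from (suc i ℕ.+ length xs) ys)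
      ≡⟨ +-assoc row _ _ ⟨
    row + ρ₂-from (suc i) xs + ρ₂-from (suc i ℕ.+ length xs) ys
      ≡⟨ cong (λ j → row + ρ₂-from (suc i) xs + ρ₂-from j ys) (ℕ.+-suc i (length xs)) ⟨
    row + ρ₂-from (suc i) xs + ρ₂-from (i ℕ.+ suc (length xs)) ys
      ∎
    where
    row : ℤ
    row = + x * (+ x - + 2 * + i + + 1)

  ρ₂-from-replicate : ∀ k v i → ρ₂-from i (replicate k v) ≡ + k * + v * (+ v + + 2 - + 2 * + i - + k)
  ρ₂-from-replicate zero    v i = refl
  ρ₂-from-replicate (suc k) v i = begin
    row + ρ₂-from (suc i) (replicate k v)
      ≡⟨ cong (_+_ row) (ρ₂-from-replicate k v (suc i)) ⟩
    row + + k * + v * (+ v + + 2 - + 2 * + suc i - + k)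
      ≡⟨ arith (+ k) (+ v) (+ i) ⟩
    + suc k * + v * (+ v + + 2 - + 2 * + i - + suc k)
      ∎
    where
    row : ℤ
    row = + v * (+ v - + 2 * + i + + 1)
    arith : ∀ k v i → v * (v - + 2 * i + + 1) + k * v * (v + + 2 - + 2 * (+ 1 + i) - k)
                      ≡ (+ 1 + k) * v * (v + + 2 - + 2 * i - (+ 1 + k))
    arith = solve-∀

  ρ₂-stair : ∀ p q r k m → ρ₂-from 1 (stair p q r k m)
             ≡ + p * (+ p - + 1) + + q * (+ q - + 3) + + r * (+ r - + 5) - + 12
               - + 2 * + k * (+ k + + 6) - + m * (+ m + + 2 * + k + + 7)
  ρ₂-stair p q r k m = begin
    ρ₂-from 1 (rows ++ twos ++ ones)
      ≡⟨ ρ₂-from-++ 1 rows (twos ++ ones) ⟩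
    ρ₂-from 1 rows + ρ₂-from 5 (twos ++ ones)
      ≡⟨ cong (_+_ (ρ₂-from 1 rows)) (ρ₂-from-++ 5 twos ones) ⟩
    ρ₂-from 1 rows + (ρ₂-from 5 twos + ρ₂-from (5 ℕ.+ length twos) ones)
      ≡⟨ cong (λ j → ρ₂-from 1 rows + (ρ₂-from 5 twos + ρ₂-from (5 ℕ.+ j) ones)) (length-replicate k) ⟩
    ρ₂-from 1 rows + (ρ₂-from 5 twos + ρ₂-from (5 ℕ.+ k) ones)
      ≡⟨ cong₂ (λ u v → ρ₂-from 1 rows + (u + v)) (ρ₂-from-replicate k 2 5) (ρ₂-from-replicate m 1 (5 ℕ.+ k)) ⟩
    ρ₂-from 1 rows + (+ k * + 2 * (+ 2 + + 2 - + 2 * + 5 - + k) + + m * + 1 * (+ 1 + + 2 - + 2 * (+ 5 + + k) - + m))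
      ≡⟨ arith (+ p) (+ q) (+ r) (+ k) (+ m) ⟩
    + p * (+ p - + 1) + + q * (+ q - + 3) + + r * (+ r - + 5) - + 12
      - + 2 * + k * (+ k + + 6) - + m * (+ m + + 2 * + k + + 7)
      ∎
    where
    rows twos ones : List ℕ
    rows = p ∷ q ∷ r ∷ 3 ∷ []
    twos = replicate k 2
    ones = replicate m 1
    arith : ∀ p q r k m →
      p * (p - + 2 * + 1 + + 1) + (q * (q - + 2 * + 2 + + 1) + (r * (r - + 2 * + 3 + + 1)
        + (+ 3 * (+ 3 - + 2 * + 4 + + 1) + + 0)))
        + (k * + 2 * (+ 2 + + 2 - + 2 * + 5 - k) + m * + 1 * (+ 1 + + 2 - + 2 * (+ 5 + k) - m))
      ≡ p * (p - + 1) + q * (q - + 3) + r * (r - + 5) - + 12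
        - + 2 * k * (k + + 6) - m * (m + + 2 * k + + 7)
    arith = solve-∀

  +[m∸n]≡+m-+n : ∀ {m n} → n ℕ.≤ m → + (m ℕ.∸ n) ≡ + m - + n
  +[m∸n]≡+m-+n {m} {n} n≤m = trans (sym (⊖-≥ n≤m)) (sym (m-n≡m⊖n m n))

  module _ (a : ℕ) {b t : ℕ} (3≤b : 3 ℕ.≤ b) (2b≤t : 2 ℕ.* b ℕ.≤ t) where
    private
      +[b∸3] : + (b ℕ.∸ 3) ≡ + b - + 3
      +[b∸3] = +[m∸n]≡+m-+n 3≤b
      +[t∸b] : + (t ℕ.∸ b) ≡ + t - + b
      +[t∸b] = +[m∸n]≡+m-+n (ℕ.≤-trans (ℕ.m≤m+n b (b ℕ.+ 0)) 2b≤t)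
      +[t∸2b] : + (t ℕ.∸ 2 ℕ.* b) ≡ + t - + 2 * + b
      +[t∸2b] = trans (+[m∸n]≡+m-+n 2b≤t) (cong (+ t -_) (pos-* 2 b))

    sum-shape : sum (shape a b t) ≡ a ℕ.+ 2 ℕ.* t
    sum-shape = +-injective (begin
      + sum (shape a b t)
        ≡⟨ cong (λ s → + (t ℕ.∸ b ℕ.+ 1 ℕ.+ (a ℕ.+ 1 ℕ.+ (b ℕ.+ 1 ℕ.+ (3 ℕ.+ s))))) sum-tail ⟩
      + (t ℕ.∸ b) + + 1
        + (+ a + + 1 + (+ b + + 1 + (+ 3 + (+ ((b ℕ.∸ 3) ℕ.* 2) + + ((t ℕ.∸ 2 ℕ.* b) ℕ.* 1)))))
        ≡⟨ cong₂ (λ u v → + (t ℕ.∸ b) + + 1 + (+ a + + 1 + (+ b + + 1 + (+ 3 + (u + v)))))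
                 (pos-* (b ℕ.∸ 3) 2) (pos-* (t ℕ.∸ 2 ℕ.* b) 1) ⟩
      + (t ℕ.∸ b) + + 1
        + (+ a + + 1 + (+ b + + 1 + (+ 3 + (+ (b ℕ.∸ 3) * + 2 + + (t ℕ.∸ 2 ℕ.* b) * + 1))))
        ≡⟨ evaluate +[t∸b] +[b∸3] +[t∸2b] ⟩
      + a + + 2 * + t
        ≡⟨ cong (_+_ (+ a)) (pos-* 2 t) ⟨
      + (a ℕ.+ 2 ℕ.* t)
        ∎)
      where
      sum-tail : sum (replicate (b ℕ.∸ 3) 2 ++ replicate (t ℕ.∸ 2 ℕ.* b) 1)
                 ≡ (b ℕ.∸ 3) ℕ.* 2 ℕ.+ (t ℕ.∸ 2 ℕ.* b) ℕ.* 1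
      sum-tail = trans (sum-++ (replicate (b ℕ.∸ 3) 2) (replicate (t ℕ.∸ 2 ℕ.* b) 1))
                       (cong₂ ℕ._+_ (sum-replicate (b ℕ.∸ 3) 2) (sum-replicate (t ℕ.∸ 2 ℕ.* b) 1))
      -- Stated for arbitrary d, k, m so that matching on refl turns the casts of truncated
      -- differences into integer differences, leaving a ring identity in a, b, t.
      evaluate : ∀ {d k m} → d ≡ + t - + b → k ≡ + b - + 3 → m ≡ + t - + 2 * + b →
                 d + + 1 + (+ a + + 1 + (+ b + + 1 + (+ 3 + (k * + 2 + m * + 1)))) ≡ + a + + 2 * + t
      evaluate refl refl refl = identity (+ a) (+ b) (+ t)
        where
        identity : ∀ a b t → t - b + + 1 + (a + + 1 + (b + + 1 + (+ 3 + ((b - + 3) * + 2 + (t - + 2 * b) * + 1))))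
                             ≡ a + + 2 * t
        identity = solve-∀

    ρ-shape : ρ (shape a b t) ≡ + (a C 2) - + b
    ρ-shape = *-cancelˡ-≡ (+ 2) _ _ (begin
      + 2 * ρ (shape a b t)
        ≡⟨ 2ρ-from≡ρ₂-from 1 (shape a b t) ⟩
      ρ₂-from 1 (shape a b t)
        ≡⟨ ρ₂-stair (t ℕ.∸ b ℕ.+ 1) (a ℕ.+ 1) (b ℕ.+ 1) (b ℕ.∸ 3) (t ℕ.∸ 2 ℕ.* b) ⟩
      (+ (t ℕ.∸ b) + + 1) * (+ (t ℕ.∸ b) + + 1 - + 1) + (+ a + + 1) * (+ a + + 1 - + 3)
        + (+ b + + 1) * (+ b + + 1 - + 5) - + 12 - + 2 * + (b ℕ.∸ 3) * (+ (b ℕ.∸ 3) + + 6)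
        - + (t ℕ.∸ 2 ℕ.* b) * (+ (t ℕ.∸ 2 ℕ.* b) + + 2 * + (b ℕ.∸ 3) + + 7)
        ≡⟨ evaluate +[t∸b] +[b∸3] +[t∸2b] ⟩
      + a * (+ a - + 1) - + 2 * + b
        ≡⟨ cong (_- + 2 * + b) (2*nC2≡n*[n-1] a) ⟨
      + 2 * + (a C 2) - + 2 * + b
        ≡⟨ x[y-z]≈xy-xz (+ 2) (+ (a C 2)) (+ b) ⟨
      + 2 * (+ (a C 2) - + b)
        ∎)
      where
      evaluate : ∀ {d k m} → d ≡ + t - + b → k ≡ + b - + 3 → m ≡ + t - + 2 * + b →
                 (d + + 1) * (d + + 1 - + 1) + (+ a + + 1) * (+ a + + 1 - + 3)
                   + (+ b + + 1) * (+ b + + 1 - + 5) - + 12 - + 2 * k * (k + + 6)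
                   - m * (m + + 2 * k + + 7)
                 ≡ + a * (+ a - + 1) - + 2 * + b
      evaluate refl refl refl = identity (+ a) (+ b) (+ t)
        where
        identity : ∀ a b t →
          (t - b + + 1) * (t - b + + 1 - + 1) + (a + + 1) * (a + + 1 - + 3)
            + (b + + 1) * (b + + 1 - + 5) - + 12 - + 2 * (b - + 3) * (b - + 3 + + 6)
            - (t - + 2 * b) * (t - + 2 * b + + 2 * (b - + 3) + + 7)
          ≡ a * (a - + 1) - + 2 * b
        identity = solve-∀

open import Data.Nat using (_≤_; _≥_; _>_; _+_; _*_; _∸_; _/_; z≤n; s≤s)
open import Data.Nat.Properties
open import Data.Nat.DivMod using (m/n*n≤m)
open import Data.Nat.Divisibility using (_∣_; divides)
open import Data.Nat.Tactic.RingSolver using (solve-∀)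
open import Data.Integer using (+_) renaming (_-_ to _-ℤ_)
open import Data.List.Relation.Unary.All using (All; _∷_)
open import Data.List.Relation.Unary.All.Properties using (++⁺; replicate⁺)
open import Data.List.Relation.Unary.Linked using (Linked; [-]; _∷_)

half-excess : ∀ {n a b} → 2 ≤ a → a ≤ (n + 4) / 5 → 2 ∣ n ∸ a → b ≤ a ∸ 2 →
              ∃[ t ] n ≡ a + 2 * t × a + b ≤ t
half-excess {n} {a} {b} 2≤a a≤[n+4]/5 (divides t n∸a≡t*2) b≤a∸2 = t , n≡a+2t , a+b≤t
  where
  b+2≤a : b + 2 ≤ a
  b+2≤a = subst (λ x → b + 2 ≤ x) (m∸n+n≡m 2≤a) (+-monoˡ-≤ 2 b≤a∸2)
  a+2[a+b]≤n : a + 2 * (a + b) ≤ n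
  a+2[a+b]≤n = +-cancelʳ-≤ 4 _ _ (begin
    a + 2 * (a + b) + 4  ≡⟨ regroup a b ⟩
    3 * a + 2 * (b + 2)  ≤⟨ +-monoʳ-≤ (3 * a) (*-monoʳ-≤ 2 b+2≤a) ⟩
    3 * a + 2 * a        ≡⟨ five a ⟩
    a * 5                ≤⟨ *-monoˡ-≤ 5 a≤[n+4]/5 ⟩
    (n + 4) / 5 * 5      ≤⟨ m/n*n≤m (n + 4) 5 ⟩
    n + 4                ∎)
    where
    open ≤-Reasoning
    regroup : ∀ a b → a + 2 * (a + b) + 4 ≡ 3 * a + 2 * (b + 2)
    regroup = solve-∀
    five : ∀ a → 3 * a + 2 * a ≡ a * 5
    five = solve-∀
  n≡a+2t : n ≡ a + 2 * t
  n≡a+2t = begin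
    n            ≡⟨ m+[n∸m]≡n (m+n≤o⇒m≤o a a+2[a+b]≤n) ⟨
    a + (n ∸ a)  ≡⟨ cong (_+_ a) (trans n∸a≡t*2 (*-comm t 2)) ⟩
    a + 2 * t    ∎
    where open ≡-Reasoning
  a+b≤t : a + b ≤ t
  a+b≤t = *-cancelˡ-≤ 2 (+-cancelˡ-≤ a _ _ (subst (λ x → a + 2 * (a + b) ≤ x) n≡a+2t a+2[a+b]≤n))

[2t∸2c]/2≡t∸c : ∀ t c → (2 * t ∸ 2 * c) / 2 ≡ t ∸ c
[2t∸2c]/2≡t∸c t c = trans (cong (_/ 2) (sym (*-distribˡ-∸ 2 t c))) (2*n/2≡n (t ∸ c))

[2t∸2c+2]/2≡t∸c+1 : ∀ t c → (2 * t ∸ 2 * c + 2) / 2 ≡ t ∸ c + 1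
[2t∸2c+2]/2≡t∸c+1 t c = begin
  (2 * t ∸ 2 * c + 2) / 2   ≡⟨ cong (λ x → (x + 2) / 2) (*-distribˡ-∸ 2 t c) ⟨
  (2 * (t ∸ c) + 2) / 2     ≡⟨ cong (_/ 2) (*-distribˡ-+ 2 (t ∸ c) 1) ⟨
  2 * (t ∸ c + 1) / 2       ≡⟨ 2*n/2≡n (t ∸ c + 1) ⟩
  t ∸ c + 1                 ∎
  where open ≡-Reasoning

[2t∸4b]/2≡t∸2b : ∀ t b → (2 * t ∸ 4 * b) / 2 ≡ t ∸ 2 * b
[2t∸4b]/2≡t∸2b t b = trans (cong (λ c → (2 * t ∸ c) / 2) (*-assoc 2 2 b)) ([2t∸2c]/2≡t∸c t (2 * b))

staircase⁺ : ∀ k m {x y z} → z ≤ y → y ≤ x → Linked _≥_ (x ∷ (replicate k y ++ replicate m z))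
staircase⁺ zero    zero    z≤y y≤x = [-]
staircase⁺ zero    (suc m) z≤y y≤x = ≤-trans z≤y y≤x ∷ staircase⁺ zero m ≤-refl ≤-refl
staircase⁺ (suc k) m       z≤y y≤x = y≤x ∷ staircase⁺ k m z≤y ≤-refl

2b≤a+b : ∀ {a b} → b ≤ a → 2 * b ≤ a + b
2b≤a+b {a} {b} b≤a = subst (_≤ a + b) (cong (_+_ b) (sym (+-identityʳ b))) (+-monoˡ-≤ b b≤a)

shape-isPartition : ∀ {a b t} → 3 ≤ b → b ≤ a → a + b ≤ t → IsPartitionOf (a + 2 * t) (shape a b t)
shape-isPartition {a} {b} {t} 3≤b b≤a a+b≤t =
  sum-shape a 3≤b (≤-trans (2b≤a+b b≤a) a+b≤t) , positive , ordered
  where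
  positive : All (_> 0) (shape a b t)
  positive = m≤n+m 1 (t ∸ b) ∷ m≤n+m 1 a ∷ m≤n+m 1 b ∷ s≤s z≤n
           ∷ ++⁺ (replicate⁺ (b ∸ 3) (s≤s z≤n)) (replicate⁺ (t ∸ 2 * b) (s≤s z≤n))
  ordered : Linked _≥_ (shape a b t)
  ordered = +-monoˡ-≤ 1 (m+n≤o⇒m≤o∸n a a+b≤t) ∷ +-monoˡ-≤ 1 b≤a ∷ ≤-trans 3≤b (m≤m+n b 1)
          ∷ staircase⁺ (b ∸ 3) (t ∸ 2 * b) (s≤s z≤n) (s≤s (s≤s z≤n))

lemma3p10 : (n : ℕ) → 26 ≤ n →
    (a : ℕ) → 6 ≤ a → a ≤ (n + 4) / 5 → 2 ∣ (n ∸ a) →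
    (b : ℕ) → 4 ≤ b → b ≤ a ∸ 2 →
    let λs = ((n ∸ a ∸ 2 * b + 2) / 2) ∷ (a + 1) ∷ (b + 1) ∷ 3 ∷
               (replicate (b ∸ 3) 2 ++ replicate ((n ∸ a ∸ 4 * b) / 2) 1)
    in IsPartitionOf n λs × CorrespondsTo λs (+ (a C 2) -ℤ + b)
lemma3p10 n _ a 6≤a a≤[n+4]/5 2∣n∸a b 4≤b b≤a∸2
  with half-excess (m+n≤o⇒n≤o 4 6≤a) a≤[n+4]/5 2∣n∸a b≤a∸2
... | t , refl , a+b≤t
  rewrite m+n∸m≡n a (2 * t) | [2t∸2c+2]/2≡t∸c+1 t b | [2t∸4b]/2≡t∸2b t b
  = shape-isPartition 3≤b b≤a a+b≤t , ρ-shape a 3≤b (≤-trans (2b≤a+b b≤a) a+b≤t)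
  where
  3≤b : 3 ≤ b
  3≤b = m+n≤o⇒n≤o 1 4≤b
  b≤a : b ≤ a
  b≤a = ≤-trans b≤a∸2 (m∸n≤m a 2)
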